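{- For a positive integer $n$, let $h_{\mathcal{D},\mathcal{E}}(n)$ (resp. $h_{\mathcal{D},\mathcal{O}}(n)$) be the number of partitions $\pi$ into distinct parts with $\Gamma(\pi)=n$ and an even (resp. odd) number of parts. Then for all $n\ge3$, $$h_{\mathcal{D},\mathcal{E}}(n)=h_{\mathcal{D},\mathcal{E}}(n-1)+h_{\mathcal{D},\mathcal{O}}(n-2),\qquad h_{\mathcal{D},\mathcal{O}}(n)=h_{\mathcal{D},\mathcal{O}}(n-1)+h_{\mathcal{D},\mathcal{E}}(n-2),$$ with initial values $h_{\mathcal{D},\mathcal{E}}(1)=h_{\mathcal{D},\mathcal{E}}(2)=0$ and $h_{\mathcal{D},\mathcal{O}}(1)=h_{\mathcal{D},\mathcal{O}}(2)=1$.
   Context: For a non-empty partition $\pi=(\pi_1\ge\cdots\ge\pi_r\ge1)$, $\ell(\pi)=r$ and $\Gamma(\pi)=\pi_1+\ell(\pi)-1$ (length of the largest hook). -}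

module Defs where

open import Data.Nat using (ℕ; zero; suc; _+_; _∸_; _<_; _>_)
open import Data.List using (List; []; _∷_; length)
open import Data.List.Membership.Propositional using (_∈_)
open import Data.List.Relation.Unary.Unique.Propositional using (Unique)
open import Data.Product using (Σ; _×_)
open import Data.Unit using (⊤)
open import Data.Empty using (⊥)
open import Function.Bundles using (_⇔_)
open import Relation.Binary.PropositionalEquality using (_≡_)

-- A partition into distinct parts, written as a list of its parts in
-- strictly decreasing order, all parts ≥ 1 (the empty partition allowed here).
data Distinct : List ℕ → Set where
  nil  : Distinct []
  one  : ∀ {a} → a > 0 → Distinct (a ∷ [])
  cons : ∀ {a b bs} → a > b → Distinct (b ∷ bs) → Distinct (a ∷ b ∷ bs)

-- Γ(π) = π₁ + ℓ(π) - 1 (length of the largest hook); only meaningful for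
-- non-empty π; we set Γ([]) = 0.
Γ : List ℕ → ℕ
Γ []       = 0
Γ (a ∷ as) = a + length as

Even : ℕ → Set
Odd  : ℕ → Set
Even zero    = ⊤
Even (suc n) = Odd n
Odd zero     = ⊥
Odd (suc n)  = Even n

IsDE : ℕ → List ℕ → Set
IsDE n π = Distinct π × (length π > 0) × (Γ π ≡ n) × Even (length π)

IsDO : ℕ → List ℕ → Set
IsDO n π = Distinct π × (length π > 0) × (Γ π ≡ n) × Odd (length π)

-- "The number of π satisfying P is k": there is a duplicate-free list
-- enumerating exactly the π with P π, and it has length k.
HasCount : (List ℕ → Set) → ℕ → Set
HasCount P k = Σ (List (List ℕ)) λ xs →
  Unique xs × (∀ π → (π ∈ xs) ⇔ P π) × (length xs ≡ k)

module Submission where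

-- Every π with Γ(π) = n + 2 arises in exactly one way from a smaller one: if π₁ > π₂ + 1
-- (or π has a single part) then lowering π₁ by one gives a partition with Γ = n + 1 and the
-- same number of parts; if π₁ = π₂ + 1 then deleting π₁ gives a partition with Γ = n and one
-- part fewer. Listing the partitions by this decomposition turns each recurrence into the
-- length of a concatenation; the list has no duplicates, so its length is the count.

open import Defs
open import Data.Nat using (ℕ; _+_; _≥_; _≤_)
open import Data.Product using (Σ; _×_)
open import Relation.Binary.PropositionalEquality using (_≡_)

open import Data.Bool using (Bool; true; false; not; if_then_else_)
open import Data.Empty using (⊥-elim)
open import Data.List using (List; []; _∷_; length; map; _++_)
open import Data.List.Membership.Propositional using (_∈_)
open import Data.List.Membership.Propositional.Properties
  using (∈-map⁻; ∈-map⁺; ∈-++⁺ˡ; ∈-++⁺ʳ)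
open import Data.List.Membership.Propositional.Properties.WithK using (unique∧set⇒bag)
open import Data.List.Properties using (length-map; length-++)
open import Data.List.Relation.Binary.BagAndSetEquality using (∼bag⇒↭)
open import Data.List.Relation.Binary.Permutation.Propositional.Properties using (↭-length)
open import Data.List.Relation.Unary.All using (All; []; _∷_)
import Data.List.Relation.Unary.All as All
import Data.List.Relation.Unary.All.Properties as All
open import Data.List.Relation.Unary.AllPairs using ([]; _∷_)
open import Data.List.Relation.Unary.Any using (here)
open import Data.List.Relation.Unary.Unique.Propositional using (Unique)
open import Data.List.Relation.Unary.Unique.Propositional.Properties using (map⁺; ++⁺)
open import Data.Nat using (zero; suc; _>_; z≤n; s≤s)
open import Data.Nat.Properties
  using (+-comm; +-suc; suc-injective; <⇒≤; <-≤-trans; <-irrefl; ≤-refl; n≮0; m<1+n⇒m<n∨m≡n)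
open import Data.Product using (_,_)
open import Data.Sum using ([_,_]′)
open import Data.Unit using (tt)
open import Function using (id; _∘′_)
open import Function.Bundles using (_⇔_; mk⇔; Equivalence)
open import Relation.Nullary using (¬_)
open import Relation.Binary.PropositionalEquality using (_≢_; refl; sym; trans; cong; cong₂; subst)
open Relation.Binary.PropositionalEquality.≡-Reasoning

HasCount-unique : ∀ {P : List ℕ → Set} {k l} → HasCount P k → HasCount P l → k ≡ l
HasCount-unique (xs , xs! , xs⇔P , refl) (ys , ys! , ys⇔P , refl) =
  ↭-length (∼bag⇒↭ (unique∧set⇒bag xs! ys! xs⇔ys))
  where
  xs⇔ys : ∀ {π} → (π ∈ xs) ⇔ (π ∈ ys)
  xs⇔ys {π} = mk⇔ (Equivalence.from (ys⇔P π) ∘′ Equivalence.to (xs⇔P π))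
                  (Equivalence.from (xs⇔P π) ∘′ Equivalence.to (ys⇔P π))

Parity : Bool → ℕ → Set
Parity true  = Even
Parity false = Odd

Parity-suc : ∀ b n → Parity b (suc n) ≡ Parity (not b) n
Parity-suc true  n = refl
Parity-suc false n = refl

IsD : Bool → ℕ → List ℕ → Set
IsD b n π = Distinct π × (length π > 0) × (Γ π ≡ n) × Parity b (length π)

Distinct-head>0 : ∀ {c r} → Distinct (c ∷ r) → c > 0
Distinct-head>0 (one c>0)      = c>0
Distinct-head>0 (cons c>d ds) = <-≤-trans (s≤s z≤n) c>d

incrementHead : List ℕ → List ℕ
incrementHead []      = []
incrementHead (c ∷ r) = suc c ∷ r

consSuccHead : List ℕ → List ℕ
consSuccHead []      = []
consSuccHead (c ∷ r) = suc c ∷ c ∷ r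

incrementHead-injective : ∀ {π σ} → incrementHead π ≡ incrementHead σ → π ≡ σ
incrementHead-injective {[]}    {[]}    _    = refl
incrementHead-injective {c ∷ r} {.c ∷ .r} refl = refl

consSuccHead-injective : ∀ {π σ} → consSuccHead π ≡ consSuccHead σ → π ≡ σ
consSuccHead-injective {[]}    {[]}    _    = refl
consSuccHead-injective {c ∷ r} {.c ∷ .r} refl = refl

incrementHead≢consSuccHead : ∀ {b n π σ} → IsD b n π → incrementHead π ≢ consSuccHead σ
incrementHead≢consSuccHead {π = []}           (_ , () , _)
incrementHead≢consSuccHead {π = c ∷ .(c ∷ s)} {.c ∷ s} (cons c>c _ , _) refl = <-irrefl refl c>c

Γ-consSuccHead : ∀ c r → Γ (consSuccHead (c ∷ r)) ≡ 2 + Γ (c ∷ r)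
Γ-consSuccHead c r = cong suc (+-suc c (length r))

incrementHead-IsD : ∀ {b n π} → IsD b n π → IsD b (suc n) (incrementHead π)
incrementHead-IsD {π = c ∷ []}    (one _ , l , g , p)       = one (s≤s z≤n) , l , cong suc g , p
incrementHead-IsD {π = c ∷ d ∷ r} (cons c>d ds , l , g , p) = cons (s≤s (<⇒≤ c>d)) ds , l , cong suc g , p

consSuccHead-IsD : ∀ {b n π} → IsD (not b) n π → IsD b (2 + n) (consSuccHead π)
consSuccHead-IsD {b} {π = c ∷ r} (ds , _ , g , p) =
  cons ≤-refl ds , s≤s z≤n , trans (Γ-consSuccHead c r) (cong (2 +_) g) ,
  subst id (sym (Parity-suc b (length (c ∷ r)))) p

hookPartitions : Bool → ℕ → List (List ℕ)
hookPartitions b     zero          = []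
hookPartitions b     (suc zero)    = if b then [] else (1 ∷ []) ∷ []
hookPartitions b     (suc (suc k)) =
  map incrementHead (hookPartitions b (suc k)) ++ map consSuccHead (hookPartitions (not b) k)

hookPartitions-sound : ∀ b n → All (IsD b n) (hookPartitions b n)
hookPartitions-sound b     zero          = []
hookPartitions-sound true  (suc zero)    = []
hookPartitions-sound false (suc zero)    = (one (s≤s z≤n) , s≤s z≤n , refl , tt) ∷ []
hookPartitions-sound b     (suc (suc k)) =
  All.++⁺ (All.map⁺ (All.map (incrementHead-IsD {b}) (hookPartitions-sound b (suc k))))
          (All.map⁺ (All.map (consSuccHead-IsD {b}) (hookPartitions-sound (not b) k)))

hookPartitions-complete : ∀ b n π → IsD b n π → π ∈ hookPartitions b n
hookPartitions-complete b n [] (_ , () , _)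
hookPartitions-complete b n (zero ∷ r) (ds , _) = ⊥-elim (n≮0 (Distinct-head>0 ds))
hookPartitions-complete b zero (suc c ∷ r) (_ , _ , () , _)
hookPartitions-complete true  (suc zero) (suc zero ∷ []) (_ , _ , _ , ())
hookPartitions-complete false (suc zero) (suc zero ∷ []) _ = here refl
hookPartitions-complete b (suc zero) (suc zero ∷ _ ∷ _) (_ , _ , () , _)
hookPartitions-complete b (suc zero) (suc (suc c) ∷ _) (_ , _ , () , _)
hookPartitions-complete b (suc (suc k)) (suc zero ∷ []) (_ , _ , () , _)
hookPartitions-complete b (suc (suc k)) (suc (suc c) ∷ []) (_ , l , g , p) =
  ∈-++⁺ˡ (∈-map⁺ incrementHead
    (hookPartitions-complete b (suc k) (suc c ∷ []) (one (s≤s z≤n) , l , suc-injective g , p)))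
hookPartitions-complete b (suc (suc k)) (suc c ∷ d ∷ r) (cons d<1+c ds , l , g , p) =
  [ (λ d<c → ∈-++⁺ˡ (∈-map⁺ incrementHead
        (hookPartitions-complete b (suc k) (c ∷ d ∷ r) (cons d<c ds , l , suc-injective g , p))))
  , (λ { refl → ∈-++⁺ʳ (map incrementHead (hookPartitions b (suc k))) (∈-map⁺ consSuccHead
        (hookPartitions-complete (not b) k (d ∷ r)
          (ds , s≤s z≤n , suc-injective (suc-injective (trans (sym (Γ-consSuccHead d r)) g)) ,
           subst id (Parity-suc b (length (d ∷ r))) p))) })
  ]′ (m<1+n⇒m<n∨m≡n d<1+c)

hookPartitions-unique : ∀ b n → Unique (hookPartitions b n)
hookPartitions-unique b     zero          = []
hookPartitions-unique true  (suc zero)    = []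
hookPartitions-unique false (suc zero)    = [] ∷ []
hookPartitions-unique b     (suc (suc k)) =
  ++⁺ (map⁺ incrementHead-injective (hookPartitions-unique b (suc k)))
      (map⁺ consSuccHead-injective (hookPartitions-unique (not b) k))
      disjoint
  where
  disjoint : ∀ {π} → ¬ (π ∈ map incrementHead (hookPartitions b (suc k))
                       × π ∈ map consSuccHead (hookPartitions (not b) k))
  disjoint (π∈₁ , π∈₂) with ∈-map⁻ incrementHead π∈₁ | ∈-map⁻ consSuccHead π∈₂
  ... | σ , σ∈ , refl | τ , _ , eq =
    incrementHead≢consSuccHead {b} (All.lookup (hookPartitions-sound b (suc k)) σ∈) eq

hookCount : Bool → ℕ → ℕ
hookCount b n = length (hookPartitions b n)

hookPartitions-count : ∀ b n → HasCount (IsD b n) (hookCount b n)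
hookPartitions-count b n =
  hookPartitions b n , hookPartitions-unique b n ,
  (λ π → mk⇔ (All.lookup (hookPartitions-sound b n)) (hookPartitions-complete b n π)) , refl

hookCount-recurrence : ∀ b k → hookCount b (2 + k) ≡ hookCount b (1 + k) + hookCount (not b) k
hookCount-recurrence b k =
  trans (length-++ (map incrementHead (hookPartitions b (1 + k))))
        (cong₂ _+_ (length-map incrementHead (hookPartitions b (1 + k)))
                   (length-map consSuccHead (hookPartitions (not b) k)))

HasCount-recurrence : ∀ b m {x y z} → HasCount (IsD b (m + 2)) x → HasCount (IsD b (m + 1)) y →
                      HasCount (IsD (not b) m) z → x ≡ y + z
HasCount-recurrence b m {x} {y} {z} hx hy hz = begin
  x                                     ≡⟨ HasCount-unique hx′ (hookPartitions-count b (2 + m)) ⟩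
  hookCount b (2 + m)                   ≡⟨ hookCount-recurrence b m ⟩
  hookCount b (1 + m) + hookCount (not b) m
    ≡⟨ cong₂ _+_ (HasCount-unique (hookPartitions-count b (1 + m)) hy′)
                 (HasCount-unique (hookPartitions-count (not b) m) hz) ⟩
  y + z                                 ∎
  where
  hx′ : HasCount (IsD b (2 + m)) x
  hx′ = subst (λ n → HasCount (IsD b n) x) (+-comm m 2) hx
  hy′ : HasCount (IsD b (1 + m)) y
  hy′ = subst (λ n → HasCount (IsD b n) y) (+-comm m 1) hy

proposition3p1 : (∀ n → n ≥ 1 → Σ ℕ (λ e → HasCount (IsDE n) e) × Σ ℕ (λ o → HasCount (IsDO n) o))
    × (∀ m → m ≥ 1 → ∀ e0 e1 e2 o0 o1 o2 →
         HasCount (IsDE (m + 2)) e0 → HasCount (IsDE (m + 1)) e1 → HasCount (IsDE m) e2 →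
         HasCount (IsDO (m + 2)) o0 → HasCount (IsDO (m + 1)) o1 → HasCount (IsDO m) o2 →
         (e0 ≡ e1 + o2) × (o0 ≡ o1 + e2))
    × HasCount (IsDE 1) 0 × HasCount (IsDE 2) 0
    × HasCount (IsDO 1) 1 × HasCount (IsDO 2) 1
proposition3p1 =
  (λ n _ → (_ , hookPartitions-count true n) , (_ , hookPartitions-count false n)) ,
  (λ m _ _ _ _ _ _ _ e₀ e₁ e₂ o₀ o₁ o₂ →
     HasCount-recurrence true m e₀ e₁ o₂ , HasCount-recurrence false m o₀ o₁ e₂) ,
  hookPartitions-count true 1 , hookPartitions-count true 2 ,
  hookPartitions-count false 1 , hookPartitions-count false 2
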